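{- For all integers $v\ge4$ and $d\ge1$, $\left|\mathcal{D}_{v,d}(132, 213)\right| = 2^{d-1}$.
   Context: A diamond with $v$ vertices ($v\ge4$) is the poset with a least element, a greatest element, and $v-2$ pairwise incomparable middle elements (in a fixed left-to-right order) strictly between them. $\mathcal{D}_{v,d}$ is the set of labellings of $d$ diamonds (placed left to right) by $1,\dots,vd$, each label used once, such that in each diamond least label $<$ each middle label $<$ greatest label. For $D\in\mathcal{D}_{v,d}$, $\pi_D$ is the permutation obtained by reading the diamonds left to right and, within each diamond, the least element, then the middle elements left to right, then the greatest element. $\mathcal{D}_{v,d}(P)$ is the set of $D$ with $\pi_D$ avoiding every classical pattern in $P$. -}

module Defs where

open import Data.Nat as ℕ using (ℕ; zero; suc; _*_; _∸_; _/_; _%_)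
import Data.Fin
open import Data.Fin using (Fin; toℕ; _<_)
open import Data.Fin.Properties using (all?; _<?_)
open import Data.Vec using (Vec; []; _∷_; lookup)
open import Data.List using (List; [_]; concatMap; map; filter; length; allFin)
open import Data.Product using (_×_)
open import Relation.Binary.PropositionalEquality using (_≡_)
open import Relation.Nullary using (¬_; Dec)
open import Relation.Nullary.Decidable using (_×-dec_; _→-dec_; ¬?)

-- Labels are 0,…,n-1 (order-isomorphic to 1,…,n); positions are 0,…,n-1.
-- A labelling D of d diamonds with v vertices is identified with its
-- reading word π_D, a vector of length n = v*d; position p lies in
-- diamond ⌊p/v⌋ with offset p mod v (offset 0 = least element,
-- offset v-1 = greatest element, others = middle elements).

blk : ℕ → ℕ → ℕ
blk zero    p = 0
blk (suc k) p = p / suc k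

off : ℕ → ℕ → ℕ
off zero    p = 0
off (suc k) p = p % suc k

module _ {n : ℕ} (π : Vec (Fin n) n) where

  -- π is a bijection Fin n → Fin n (injective on a finite set of size n)
  IsPerm : Set
  IsPerm = ∀ i j → lookup π i ≡ lookup π j → i ≡ j

  -- diamond conditions: within one diamond, least < middle < greatest
  -- (equivalently: least below every other vertex, greatest above every other)
  DiamondCond : ℕ → Set
  DiamondCond v = ∀ i j → blk v (toℕ i) ≡ blk v (toℕ j) →
    ((off v (toℕ i) ≡ 0) × ¬ (off v (toℕ j) ≡ 0) → lookup π i < lookup π j) ×
    ((off v (toℕ j) ≡ v ∸ 1) × ¬ (off v (toℕ i) ≡ v ∸ 1) → lookup π i < lookup π j)

  Avoids132 : Set
  Avoids132 = ∀ i j k → i < j → j < k →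
    ¬ (lookup π i < lookup π k × lookup π k < lookup π j)

  Avoids213 : Set
  Avoids213 = ∀ i j k → i < j → j < k →
    ¬ (lookup π j < lookup π i × lookup π i < lookup π k)

  InD132-213 : ℕ → Set
  InD132-213 v = IsPerm × DiamondCond v × Avoids132 × Avoids213

  private
    _≟ᶠ_ = Data.Fin._≟_
    _≟ⁿ_ = ℕ._≟_

  inD? : ∀ v → Dec (InD132-213 v)
  inD? v =
    all? (λ i → all? (λ j → (lookup π i ≟ᶠ lookup π j) →-dec (i ≟ᶠ j)))
    ×-dec all? (λ i → all? (λ j →
            (blk v (toℕ i) ≟ⁿ blk v (toℕ j)) →-dec
              ((((off v (toℕ i) ≟ⁿ 0) ×-dec ¬? (off v (toℕ j) ≟ⁿ 0)) →-dec (lookup π i <? lookup π j))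
               ×-dec (((off v (toℕ j) ≟ⁿ (v ∸ 1)) ×-dec ¬? (off v (toℕ i) ≟ⁿ (v ∸ 1))) →-dec (lookup π i <? lookup π j)))))
    ×-dec all? (λ i → all? (λ j → all? (λ k → (i <? j) →-dec ((j <? k) →-dec
            ¬? ((lookup π i <? lookup π k) ×-dec (lookup π k <? lookup π j))))))
    ×-dec all? (λ i → all? (λ j → all? (λ k → (i <? j) →-dec ((j <? k) →-dec
            ¬? ((lookup π j <? lookup π i) ×-dec (lookup π i <? lookup π k))))))

allVecs : {A : Set} → List A → (m : ℕ) → List (Vec A m)
allVecs xs zero    = [ [] ]
allVecs xs (suc m) = concatMap (λ x → map (x ∷_) (allVecs xs m)) xs

countD132-213 : ℕ → ℕ → ℕ
countD132-213 v d =
  length (filter (λ π → inD? π v) (allVecs (allFin (v * d)) (v * d)))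

module Submission where

-- A permutation avoiding 132 and 213 is a skew sum of increasing runs, so it is
-- determined by its descent set. In a diamond labelling the least element of each
-- diamond lies below the rest of it, so with 132 excluded there is no descent inside
-- a diamond; conversely, a skew sum of increasing runs that break only between
-- diamonds satisfies the diamond conditions. Hence the labellings correspond to the
-- 2^(d-1) sets of descents at the d - 1 boundaries between diamonds.

open import Data.Bool using (Bool; true; false; _∧_; if_then_else_)
open import Data.Empty using (⊥-elim)
open import Data.Fin as Fin using (Fin; toℕ; fromℕ<; punchOut)
open import Data.Fin.Properties
  using (toℕ<n; toℕ-fromℕ<; toℕ-injective; any?; punchOut-injective; injective⇒≤)
open import Data.List as List
  using (List; []; _∷_; _++_; length; filter; allFin; cartesianProductWith)
open import Data.List.Membership.Propositional using (_∈_)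
open import Data.List.Membership.Propositional.Properties
  using (∈-∃++; ∈-++⁻; ∈-++⁺ˡ; ∈-++⁺ʳ; ∈-cartesianProductWith⁺; ∈-filter⁺; ∈-filter⁻; ∈-allFin)
open import Data.List.Properties using (length-++; length-map; length-++-sucʳ)
open import Data.List.Relation.Unary.All as All using ([]; _∷_)
open import Data.List.Relation.Unary.AllPairs using ([]; _∷_)
open import Data.List.Relation.Unary.Any using (here; there)
open import Data.List.Relation.Unary.Unique.Propositional using (Unique)
open import Data.List.Relation.Unary.Unique.Propositional.Properties
  using (cartesianProductWith⁺; filter⁺; allFin⁺)
open import Data.Nat using (ℕ; zero; suc; _+_; _*_; _^_; _∸_; _≤_; _<_; z≤n; s≤s; NonZero; _/_; _%_)
open import Data.Nat.DivMod
  using (m≡m%n+[m/n]*n; m%n<n; m*n%n≡0; m*n/n≡m; m/n*n≤m; /-monoˡ-≤; m<n*o⇒m/o<n)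
open import Data.Nat.Induction using (<-rec)
open import Data.Nat.Properties
open import Data.Product using (∃; _,_; _×_; proj₁; proj₂)
open import Data.Sum using (_⊎_; inj₁; inj₂)
open import Data.Vec using (Vec; []; _∷_; lookup; map; tabulate)
open import Data.Vec.Properties
  using (∷-injective; lookup-map; lookup∘tabulate; tabulate∘lookup; tabulate-cong)
open import Function using (_∘_; case_of_)
open import Function.Bundles using (_⇔_; Equivalence; mk⇔)
open import Function.Properties.Equivalence using () renaming (sym to ⇔-sym)
open import Relation.Binary.Definitions using (tri<; tri≈; tri>)
open import Relation.Binary.PropositionalEquality
open import Relation.Nullary using (¬_; Dec; yes; no; does)
open import Relation.Nullary.Decidable using (dec-true; dec-false)

open import Defs

module _ {A B : Set} (f : A → B) where

  length-≤-of-injective : ∀ {xs ys} → Unique xs → (∀ {x} → x ∈ xs → f x ∈ ys) →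
    (∀ {x y} → x ∈ xs → y ∈ xs → f x ≡ f y → x ≡ y) → length xs ≤ length ys
  length-≤-of-injective {[]} _ _ _ = z≤n
  length-≤-of-injective {x ∷ xs} (x∉xs ∷ xs-unique) into injective
    with ys₁ , ys₂ , refl ← ∈-∃++ (into (here refl)) =
    subst (suc (length xs) ≤_) (sym (length-++-sucʳ ys₁ (f x) ys₂))
      (s≤s (length-≤-of-injective xs-unique into′ λ p q → injective (there p) (there q)))
    where
    into′ : ∀ {y} → y ∈ xs → f y ∈ ys₁ ++ ys₂
    into′ {y} y∈xs with ∈-++⁻ ys₁ (into (there y∈xs))
    ... | inj₁ p = ∈-++⁺ˡ p
    ... | inj₂ (there p) = ∈-++⁺ʳ ys₁ p
    ... | inj₂ (here fy≡fx) =
      ⊥-elim (All.lookup x∉xs y∈xs (sym (injective (there y∈xs) (here refl) fy≡fx)))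

module _ {A B C : Set} (f : A → B → C) where

  length-cartesianProductWith : ∀ xs ys →
    length (cartesianProductWith f xs ys) ≡ length xs * length ys
  length-cartesianProductWith []       ys = refl
  length-cartesianProductWith (x ∷ xs) ys = begin
    length (List.map (f x) ys ++ cartesianProductWith f xs ys)
      ≡⟨ length-++ (List.map (f x) ys) ⟩
    length (List.map (f x) ys) + length (cartesianProductWith f xs ys)
      ≡⟨ cong₂ _+_ (length-map (f x) ys) (length-cartesianProductWith xs ys) ⟩
    length ys + length xs * length ys ∎
    where open ≡-Reasoning

  concatMap≡cartesianProductWith : ∀ xs ys →
    List.concatMap (λ x → List.map (f x) ys) xs ≡ cartesianProductWith f xs ys
  concatMap≡cartesianProductWith []       ys = refl
  concatMap≡cartesianProductWith (x ∷ xs) ys =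
    cong (List.map (f x) ys ++_) (concatMap≡cartesianProductWith xs ys)

module _ {A : Set} (xs : List A) where

  allVecs-suc : ∀ m → allVecs xs (suc m) ≡ cartesianProductWith _∷_ xs (allVecs xs m)
  allVecs-suc m = concatMap≡cartesianProductWith _∷_ xs (allVecs xs m)

  length-allVecs : ∀ m → length (allVecs xs m) ≡ length xs ^ m
  length-allVecs zero    = refl
  length-allVecs (suc m) = begin
    length (allVecs xs (suc m))
      ≡⟨ cong length (allVecs-suc m) ⟩
    length (cartesianProductWith _∷_ xs (allVecs xs m))
      ≡⟨ length-cartesianProductWith _∷_ xs (allVecs xs m) ⟩
    length xs * length (allVecs xs m)
      ≡⟨ cong (length xs *_) (length-allVecs m) ⟩
    length xs * length xs ^ m ∎
    where open ≡-Reasoning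

  ∈-allVecs : (∀ x → x ∈ xs) → ∀ {m} (u : Vec A m) → u ∈ allVecs xs m
  ∈-allVecs complete []      = here refl
  ∈-allVecs complete {suc m} (x ∷ u) = subst ((x ∷ u) ∈_) (sym (allVecs-suc m))
    (∈-cartesianProductWith⁺ _∷_ (complete x) (∈-allVecs complete u))

  allVecs-unique : Unique xs → ∀ m → Unique (allVecs xs m)
  allVecs-unique _         zero    = [] ∷ []
  allVecs-unique xs-unique (suc m) = subst Unique (sym (allVecs-suc m))
    (cartesianProductWith⁺ _∷_ ∷-injective xs-unique (allVecs-unique xs-unique m))

injective⇒surjective : ∀ {m} (f : Fin m → Fin m) → (∀ {i j} → f i ≡ f j → i ≡ j) →
  ∀ y → ∃ λ i → f i ≡ y
injective⇒surjective {suc m} f injective y with any? (λ i → f i Fin.≟ y)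
... | yes hit = hit
... | no  miss = ⊥-elim (<-irrefl refl (injective⇒≤ {f = skip-y} skip-y-injective))
  where
  y≢f : ∀ i → y ≢ f i
  y≢f i y≡fi = miss (i , sym y≡fi)

  skip-y : Fin (suc m) → Fin m
  skip-y i = punchOut (y≢f i)

  skip-y-injective : ∀ {i j} → skip-y i ≡ skip-y j → i ≡ j
  skip-y-injective eq = injective (punchOut-injective (y≢f _) (y≢f _) eq)

lookupOr : ∀ {A : Set} {m} → A → Vec A m → ℕ → A
lookupOr d []       _       = d
lookupOr d (x ∷ xs) zero    = x
lookupOr d (x ∷ xs) (suc p) = lookupOr d xs p

lookupOr-toℕ : ∀ {A : Set} {m} (d : A) (xs : Vec A m) (i : Fin m) →
  lookupOr d xs (toℕ i) ≡ lookup xs i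
lookupOr-toℕ d (x ∷ xs) Fin.zero    = refl
lookupOr-toℕ d (x ∷ xs) (Fin.suc i) = lookupOr-toℕ d xs i

toFin : ∀ {n p} → p < n → ∃ λ (i : Fin n) → toℕ i ≡ p
toFin p<n = fromℕ< p<n , toℕ-fromℕ< p<n

valueAt : ∀ {n m} → Vec (Fin n) m → ℕ → ℕ
valueAt π = lookupOr 0 (map toℕ π)

valueAt-represents : ∀ {n m} (π : Vec (Fin n) m) i → toℕ (lookup π i) ≡ valueAt π (toℕ i)
valueAt-represents π i = sym (trans (lookupOr-toℕ 0 (map toℕ π) i) (lookup-map i toℕ π))

-- Permutations avoiding 132 and 213

ascents⇒< : ∀ (g : ℕ → ℕ) {q p} → q < p →
  (∀ {t} → q ≤ t → t < p → g t < g (suc t)) → g q < g p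
ascents⇒< g {q} {suc p} (s≤s q≤p) ascent with m≤n⇒m<n∨m≡n q≤p
... | inj₂ refl = ascent ≤-refl (n<1+n q)
... | inj₁ q<p  = <-trans (ascents⇒< g q<p λ q≤t t<p → ascent q≤t (m<n⇒m<1+n t<p))
                          (ascent (<⇒≤ q<p) (n<1+n p))

record Av132∧213 (n : ℕ) (g : ℕ → ℕ) : Set where
  field
    injective : ∀ {p q} → p < n → q < n → g p ≡ g q → p ≡ q
    avoids132 : ∀ {i j k} → i < j → j < k → k < n → ¬ (g i < g k × g k < g j)
    avoids213 : ∀ {i j k} → i < j → j < k → k < n → ¬ (g j < g i × g i < g k)

  ≯⇒< : ∀ {p q} → p < n → q < n → p ≢ q → ¬ g q < g p → g p < g q
  ≯⇒< {p} {q} p<n q<n p≢q g≯ with <-cmp (g p) (g q)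
  ... | tri< gp<gq _ _ = gp<gq
  ... | tri≈ _ gp≡gq _ = ⊥-elim (p≢q (injective p<n q<n gp≡gq))
  ... | tri> _ _ gq<gp = ⊥-elim (g≯ gq<gp)

  ascent : ∀ {t} → suc t < n → ¬ g (suc t) < g t → g t < g (suc t)
  ascent {t} st<n = ≯⇒< (<-trans (n<1+n t) st<n) st<n (<⇒≢ (n<1+n t))

  -- A rise g q < g p puts every entry between q and p above g q (else 213),
  -- and then every step after q is an ascent (else 132).
  <⇒above : ∀ {q p k} → p < n → g q < g p → q < k → k ≤ p → g q < g k
  <⇒above {q} {p} {k} p<n gq<gp q<k k≤p with m≤n⇒m<n∨m≡n k≤p
  ... | inj₂ refl = gq<gp
  ... | inj₁ k<p  = ≯⇒< (<-trans q<k k<n) k<n (<⇒≢ q<k)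
                        λ gk<gq → avoids213 q<k k<p p<n (gk<gq , gq<gp)
    where k<n = <-trans k<p p<n

  <⇒ascents : ∀ {q p} → p < n → g q < g p →
    ∀ {t} → q ≤ t → t < p → g t < g (suc t)
  <⇒ascents {q} {p} p<n gq<gp {t} q≤t t<p with m≤n⇒m<n∨m≡n q≤t
  ... | inj₂ refl = <⇒above p<n gq<gp (n<1+n q) t<p
  ... | inj₁ q<t  = ascent (≤-<-trans t<p p<n) λ gst<gt →
    avoids132 q<t (n<1+n t) (≤-<-trans t<p p<n) (<⇒above p<n gq<gp (s≤s q≤t) t<p , gst<gt)

SameAscents : ℕ → (ℕ → ℕ) → (ℕ → ℕ) → Set
SameAscents n g h = ∀ {t} → suc t < n → (g t < g (suc t) ⇔ h t < h (suc t))

module _ {n : ℕ} {g h : ℕ → ℕ} (G : Av132∧213 n g) (H : Av132∧213 n h) where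
  open Equivalence

  same-ascents⇒same-order : SameAscents n g h →
    ∀ {q p} → q < n → p < n → g q < g p → h q < h p
  same-ascents⇒same-order same {q} {p} q<n p<n gq<gp with <-cmp q p
  ... | tri< q<p _ _ = ascents⇒< h q<p λ q≤t t<p →
    to (same (≤-<-trans t<p p<n)) (Av132∧213.<⇒ascents G p<n gq<gp q≤t t<p)
  ... | tri≈ _ refl _ = ⊥-elim (<-irrefl refl gq<gp)
  ... | tri> _ _ p<q = Av132∧213.≯⇒< H q<n p<n (<⇒≢ p<q ∘ sym) λ hp<hq →
    <-asym gq<gp (ascents⇒< g p<q λ p≤t t<q →
      from (same (≤-<-trans t<q q<n)) (Av132∧213.<⇒ascents H q<n hp<hq p≤t t<q))

descent-agreement⇒ascent : ∀ {n t} {g h : ℕ → ℕ} → Av132∧213 n h → suc t < n →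
  does (g (suc t) <? g t) ≡ does (h (suc t) <? h t) → g t < g (suc t) → h t < h (suc t)
descent-agreement⇒ascent {t = t} {g} {h} H st<n same gt<gst = Av132∧213.ascent H st<n λ hst<ht →
  case trans (sym (dec-false (g (suc t) <? g t) (<-asym gt<gst)))
             (trans same (dec-true (h (suc t) <? h t) hst<ht))
  of λ ()

MapsInto : ℕ → (ℕ → ℕ) → Set
MapsInto n g = ∀ {p} → p < n → g p < n

Onto : ℕ → (ℕ → ℕ) → Set
Onto n g = ∀ {x} → x < n → ∃ λ p → p < n × g p ≡ x

-- Induction on g p: if g p < h p, the value g p of h is taken at some q with
-- g q < g p, and the hypothesis at q gives h q ≤ g q < g p = h q.
reflects-order⇒≤ : ∀ {n} {g h : ℕ → ℕ} → MapsInto n g → Onto n h →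
  (∀ {q p} → q < n → p < n → h q < h p → g q < g p) →
  ∀ {p} → p < n → h p ≤ g p
reflects-order⇒≤ {n} {g} {h} g<n h-onto reflects {p} p<n = <-rec P below (g p) p<n refl
  where
  P : ℕ → Set
  P x = ∀ {p} → p < n → g p ≡ x → h p ≤ x

  below : ∀ x → (∀ {y} → y < x → P y) → P x
  below _ rec {p} p<n refl with h p ≤? g p
  ... | yes hp≤gp = hp≤gp
  ... | no  hp≰gp =
    let q , q<n , hq≡gp = h-onto (g<n p<n)
        gq<gp = reflects q<n p<n (subst (_< h p) (sym hq≡gp) (≰⇒> hp≰gp))
    in ⊥-elim (<⇒≱ gq<gp (subst (_≤ g q) hq≡gp (rec gq<gp q<n refl)))

same-order⇒≡ : ∀ {n} {g h : ℕ → ℕ} → MapsInto n g → MapsInto n h → Onto n g → Onto n h →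
  (∀ {q p} → q < n → p < n → g q < g p → h q < h p) →
  (∀ {q p} → q < n → p < n → h q < h p → g q < g p) →
  ∀ {p} → p < n → g p ≡ h p
same-order⇒≡ g<n h<n g-onto h-onto preserves reflects p<n =
  ≤-antisym (reflects-order⇒≤ h<n g-onto preserves p<n) (reflects-order⇒≤ g<n h-onto reflects p<n)

-- Skew sums of increasing runs

n<m⇒m∸n≡1+[m∸1+n] : ∀ {m n} → n < m → m ∸ n ≡ suc (m ∸ suc n)
n<m⇒m∸n≡1+[m∸1+n] {suc m} {zero}  _         = refl
n<m⇒m∸n≡1+[m∸1+n] {suc m} {suc n} (s≤s n<m) = n<m⇒m∸n≡1+[m∸1+n] n<m

-- cut t says that a new block starts at position t; block [s, e) receives the
-- values [n - e, n - s), so each block is increasing and lies above all later ones.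
module SkewLayered (n : ℕ) (cut : ℕ → Bool) where

  blockStart : ℕ → ℕ
  blockStart zero    = zero
  blockStart (suc p) = if cut (suc p) then suc p else blockStart p

  blockEndFrom : ℕ → ℕ → ℕ
  blockEndFrom k zero       = k
  blockEndFrom k (suc fuel) = if cut k then k else blockEndFrom (suc k) fuel

  blockEnd : ℕ → ℕ
  blockEnd p = blockEndFrom (suc p) (n ∸ suc p)

  layered : ℕ → ℕ
  layered p = (n ∸ blockEnd p) + (p ∸ blockStart p)

  blockStart≤ : ∀ p → blockStart p ≤ p
  blockStart≤ zero    = z≤n
  blockStart≤ (suc p) with cut (suc p)
  ... | true  = ≤-refl
  ... | false = m≤n⇒m≤1+n (blockStart≤ p)

  ≤blockEndFrom : ∀ k fuel → k ≤ blockEndFrom k fuel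
  ≤blockEndFrom k zero       = ≤-refl
  ≤blockEndFrom k (suc fuel) with cut k
  ... | true  = ≤-refl
  ... | false = <⇒≤ (≤blockEndFrom (suc k) fuel)

  blockEndFrom≤ : ∀ k fuel → blockEndFrom k fuel ≤ k + fuel
  blockEndFrom≤ k zero       = ≤-reflexive (sym (+-identityʳ k))
  blockEndFrom≤ k (suc fuel) with cut k
  ... | true  = m≤m+n k (suc fuel)
  ... | false = ≤-trans (blockEndFrom≤ (suc k) fuel) (≤-reflexive (sym (+-suc k fuel)))

  <blockEnd : ∀ p → p < blockEnd p
  <blockEnd p = ≤blockEndFrom (suc p) (n ∸ suc p)

  blockEnd≤n : ∀ {p} → p < n → blockEnd p ≤ n
  blockEnd≤n {p} p<n = ≤-trans (blockEndFrom≤ (suc p) (n ∸ suc p)) (≤-reflexive (m+[n∸m]≡n p<n))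

  blockEnd-step : ∀ {t} → suc t < n →
    blockEnd t ≡ (if cut (suc t) then suc t else blockEnd (suc t))
  blockEnd-step st<n rewrite n<m⇒m∸n≡1+[m∸1+n] st<n = refl

  cut⇒blockStart≡ : ∀ {t} → cut (suc t) ≡ true → blockStart (suc t) ≡ suc t
  cut⇒blockStart≡ c rewrite c = refl

  ¬cut⇒blockStart≡ : ∀ {t} → cut (suc t) ≡ false → blockStart (suc t) ≡ blockStart t
  ¬cut⇒blockStart≡ c rewrite c = refl

  cut⇒blockEnd≡ : ∀ {t} → suc t < n → cut (suc t) ≡ true → blockEnd t ≡ suc t
  cut⇒blockEnd≡ st<n c rewrite blockEnd-step st<n | c = refl

  ¬cut⇒blockEnd≡ : ∀ {t} → suc t < n → cut (suc t) ≡ false → blockEnd t ≡ blockEnd (suc t)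
  ¬cut⇒blockEnd≡ st<n c rewrite blockEnd-step st<n | c = refl

  SameBlock : ℕ → ℕ → Set
  SameBlock p q = blockStart p ≡ blockStart q × blockEnd p ≡ blockEnd q

  SameBlock-trans : ∀ {p q r} → SameBlock p q → SameBlock q r → SameBlock p r
  SameBlock-trans (s₁ , e₁) (s₂ , e₂) = trans s₁ s₂ , trans e₁ e₂

  ¬cut⇒SameBlock : ∀ {t} → suc t < n → cut (suc t) ≡ false → SameBlock t (suc t)
  ¬cut⇒SameBlock st<n c = sym (¬cut⇒blockStart≡ c) , ¬cut⇒blockEnd≡ st<n c

  SameBlock⊎before : ∀ {p q} → p ≤ q → q < n → SameBlock p q ⊎ blockEnd p ≤ blockStart q
  SameBlock⊎before {q = zero}  z≤n _ = inj₁ (refl , refl)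
  SameBlock⊎before {p} {suc q} p≤sq sq<n with m≤n⇒m<n∨m≡n p≤sq
  ... | inj₂ refl = inj₁ (refl , refl)
  ... | inj₁ (s≤s p≤q) with SameBlock⊎before p≤q (<-trans (n<1+n q) sq<n) | cut (suc q) in c
  ...   | inj₁ (s , e) | true  = inj₂ (≤-reflexive (trans e (cut⇒blockEnd≡ sq<n c)))
  ...   | inj₁ (s , e) | false = inj₁ (s , trans e (¬cut⇒blockEnd≡ sq<n c))
  ...   | inj₂ before  | true  = inj₂ (≤-trans before (m≤n⇒m≤1+n (blockStart≤ q)))
  ...   | inj₂ before  | false = inj₂ before

  SameBlock-between : ∀ {i j k} → i ≤ j → j ≤ k → k < n → SameBlock i k →
    SameBlock i j × SameBlock j k
  SameBlock-between {i} {j} {k} i≤j j≤k k<n (s , e) with SameBlock⊎before i≤j (≤-<-trans j≤k k<n)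
  ... | inj₁ (s′ , e′) = (s′ , e′) , (trans (sym s′) s , trans (sym e′) e)
  ... | inj₂ before    = ⊥-elim (<-irrefl refl (begin-strict
    blockEnd i   ≤⟨ before ⟩
    blockStart j ≤⟨ blockStart≤ j ⟩
    j            ≤⟨ j≤k ⟩
    k            <⟨ <blockEnd k ⟩
    blockEnd k   ≡⟨ e ⟨
    blockEnd i   ∎))
    where open ≤-Reasoning

  uncut⇒SameBlock : ∀ {p q} → p ≤ q → q < n → (∀ {t} → p < t → t ≤ q → cut t ≡ false) →
    SameBlock p q
  uncut⇒SameBlock {q = zero}  z≤n _ _ = refl , refl
  uncut⇒SameBlock {p} {suc q} p≤sq sq<n uncut with m≤n⇒m<n∨m≡n p≤sq
  ... | inj₂ refl      = refl , refl
  ... | inj₁ (s≤s p≤q) = SameBlock-trans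
    (uncut⇒SameBlock p≤q (<-trans (n<1+n q) sq<n) λ p<t t≤q → uncut p<t (m≤n⇒m≤1+n t≤q))
    (¬cut⇒SameBlock sq<n (uncut (s≤s p≤q) ≤-refl))

  layered-<-within : ∀ {p q} → p < q → SameBlock p q → layered p < layered q
  layered-<-within {p} {q} p<q (s , e) = begin-strict
    (n ∸ blockEnd p) + (p ∸ blockStart p) ≡⟨ cong₂ (λ a b → (n ∸ a) + (p ∸ b)) e s ⟩
    (n ∸ blockEnd q) + (p ∸ blockStart q) <⟨ +-monoʳ-< (n ∸ blockEnd q) (∸-monoˡ-< p<q start≤p) ⟩
    (n ∸ blockEnd q) + (q ∸ blockStart q) ∎
    where
    open ≤-Reasoning
    start≤p : blockStart q ≤ p
    start≤p = subst (_≤ p) s (blockStart≤ p)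

  layered<n∸blockStart : ∀ {p} → p < n → layered p < n ∸ blockStart p
  layered<n∸blockStart {p} p<n = begin-strict
    (n ∸ blockEnd p) + (p ∸ blockStart p)
      <⟨ +-monoʳ-< (n ∸ blockEnd p) (∸-monoˡ-< (<blockEnd p) (blockStart≤ p)) ⟩
    (n ∸ blockEnd p) + (blockEnd p ∸ blockStart p)
      ≡⟨ +-∸-assoc (n ∸ blockEnd p) (≤-trans (blockStart≤ p) (<⇒≤ (<blockEnd p))) ⟨
    (n ∸ blockEnd p) + blockEnd p ∸ blockStart p
      ≡⟨ cong (_∸ blockStart p) (m∸n+n≡m (blockEnd≤n p<n)) ⟩
    n ∸ blockStart p ∎
    where open ≤-Reasoning

  layered<n : ∀ {p} → p < n → layered p < n
  layered<n {p} p<n = <-≤-trans (layered<n∸blockStart p<n) (m∸n≤m n (blockStart p))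

  layered-<-before : ∀ {p q} → q < n → blockEnd p ≤ blockStart q → layered q < layered p
  layered-<-before {p} {q} q<n before = begin-strict
    layered q        <⟨ layered<n∸blockStart q<n ⟩
    n ∸ blockStart q ≤⟨ ∸-monoʳ-≤ n before ⟩
    n ∸ blockEnd p   ≤⟨ m≤m+n (n ∸ blockEnd p) (p ∸ blockStart p) ⟩
    layered p        ∎
    where open ≤-Reasoning

  layered-≢ : ∀ {p q} → p < q → q < n → layered p ≢ layered q
  layered-≢ p<q q<n with SameBlock⊎before (<⇒≤ p<q) q<n
  ... | inj₁ same   = <⇒≢ (layered-<-within p<q same)
  ... | inj₂ before = <⇒≢ (layered-<-before q<n before) ∘ sym

  layered-≮⇒SameBlock : ∀ {p q} → p ≤ q → q < n → ¬ layered q < layered p → SameBlock p q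
  layered-≮⇒SameBlock p≤q q<n ≮ with SameBlock⊎before p≤q q<n
  ... | inj₁ same   = same
  ... | inj₂ before = ⊥-elim (≮ (layered-<-before q<n before))

  -- In a 132 or 213 occurrence i < j < k we have layered i < layered k, so
  -- i, j, k lie in one block, where layered is increasing.
  layered-Av132∧213 : Av132∧213 n layered
  layered-Av132∧213 = record
    { injective = injective
    ; avoids132 = λ i<j j<k k<n (li<lk , lk<lj) →
        <-asym lk<lj (layered-<-within j<k (proj₂ (one-block i<j j<k k<n li<lk)))
    ; avoids213 = λ i<j j<k k<n (lj<li , li<lk) →
        <-asym lj<li (layered-<-within i<j (proj₁ (one-block i<j j<k k<n li<lk)))
    }
    where
    injective : ∀ {p q} → p < n → q < n → layered p ≡ layered q → p ≡ q
    injective {p} {q} p<n q<n eq with <-cmp p q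
    ... | tri< p<q _ _ = ⊥-elim (layered-≢ p<q q<n eq)
    ... | tri≈ _ p≡q _ = p≡q
    ... | tri> _ _ q<p = ⊥-elim (layered-≢ q<p p<n (sym eq))

    one-block : ∀ {i j k} → i < j → j < k → k < n → layered i < layered k →
      SameBlock i j × SameBlock j k
    one-block i<j j<k k<n li<lk = SameBlock-between (<⇒≤ i<j) (<⇒≤ j<k) k<n
      (layered-≮⇒SameBlock (<⇒≤ (<-trans i<j j<k)) k<n (<-asym li<lk))

  layered-descent : ∀ {t} → suc t < n → cut (suc t) ≡ true → layered (suc t) < layered t
  layered-descent st<n c = layered-<-before st<n
    (≤-reflexive (trans (cut⇒blockEnd≡ st<n c) (sym (cut⇒blockStart≡ c))))

  layered-ascent : ∀ {t} → suc t < n → cut (suc t) ≡ false → layered t < layered (suc t)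
  layered-ascent {t} st<n c = layered-<-within (n<1+n t) (¬cut⇒SameBlock st<n c)

  layered-descent≡cut : ∀ {t} → suc t < n → does (layered (suc t) <? layered t) ≡ cut (suc t)
  layered-descent≡cut {t} st<n = by-cut (cut (suc t)) refl
    where
    by-cut : ∀ b → cut (suc t) ≡ b → does (layered (suc t) <? layered t) ≡ b
    by-cut true  c = dec-true  (_ <? _) (layered-descent st<n c)
    by-cut false c = dec-false (_ <? _) (<-asym (layered-ascent st<n c))

-- Diamond labellings

module _ {v : ℕ} .{{_ : NonZero v}} where

  /-%-<⇒< : ∀ {p q} → p / v ≡ q / v → p % v < q % v → p < q
  /-%-<⇒< {p} {q} same-block %< = begin-strict
    p                   ≡⟨ m≡m%n+[m/n]*n p v ⟩
    p % v + p / v * v   ≡⟨ cong (λ b → p % v + b * v) same-block ⟩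
    p % v + q / v * v   <⟨ +-monoˡ-< (q / v * v) %< ⟩
    q % v + q / v * v   ≡⟨ m≡m%n+[m/n]*n q v ⟨
    q                   ∎
    where open ≤-Reasoning

  /-squeeze : ∀ {p t q} → p ≤ t → t ≤ q → p / v ≡ q / v → t / v ≡ p / v
  /-squeeze {p} {t} {q} p≤t t≤q same = ≤-antisym
    (subst (t / v ≤_) (sym same) (/-monoˡ-≤ v t≤q)) (/-monoˡ-≤ v p≤t)

  %≡0⇒≤ : ∀ {t p} → t % v ≡ 0 → t / v ≡ p / v → t ≤ p
  %≡0⇒≤ {t} {p} t%v≡0 same = begin
    t                 ≡⟨ m≡m%n+[m/n]*n t v ⟩
    t % v + t / v * v ≡⟨ cong₂ (λ r b → r + b * v) t%v≡0 same ⟩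
    p / v * v         ≤⟨ m/n*n≤m p v ⟩
    p                 ∎
    where open ≤-Reasoning

  %≢0-within : ∀ {p t q} → p / v ≡ q / v → p < t → t ≤ q → t % v ≢ 0
  %≢0-within same p<t t≤q t%v≡0 =
    <⇒≱ p<t (%≡0⇒≤ t%v≡0 (/-squeeze (<⇒≤ p<t) t≤q same))

  [1+t]/v≡t/v : ∀ t → suc t % v ≢ 0 → suc t / v ≡ t / v
  [1+t]/v≡t/v t [1+t]%v≢0 = ≤-antisym [1+t]/v≤t/v (/-monoˡ-≤ v (n≤1+n t))
    where
    start-of-[1+t] : suc t / v * v ≢ suc t
    start-of-[1+t] eq = [1+t]%v≢0 (trans (cong (_% v) (sym eq)) (m*n%n≡0 (suc t / v) v))

    [1+t]/v≤t/v : suc t / v ≤ t / v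
    [1+t]/v≤t/v = subst (_≤ t / v) (m*n/n≡m (suc t / v) v)
      (/-monoˡ-≤ v (≤-pred (≤∧≢⇒< (m/n*n≤m (suc t) v) start-of-[1+t])))

module Diamonds (w : ℕ) where

  v : ℕ
  v = suc w

  record IsDiamondLabelling (n : ℕ) (g : ℕ → ℕ) : Set where
    field
      least<    : ∀ {p q} → p < n → q < n → p / v ≡ q / v → p % v ≡ 0 → q % v ≢ 0 → g p < g q
      <greatest : ∀ {p q} → p < n → q < n → p / v ≡ q / v → q % v ≡ w → p % v ≢ w → g p < g q

  module _ {n : ℕ} {g : ℕ → ℕ} (G : Av132∧213 n g) (D : IsDiamondLabelling n g) where
    open Av132∧213 G
    open IsDiamondLabelling D

    -- With s the first position of the diamond of t, a descent at t would make
    -- s, t, t + 1 an occurrence of 132.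
    ascent-within-diamond : ∀ {t} → suc t < n → suc t % v ≢ 0 → g t < g (suc t)
    ascent-within-diamond {t} st<n [1+t]%v≢0 = ascent st<n (no-descent (t % v ≟ 0))
      where
      t<n : t < n
      t<n = <-trans (n<1+n t) st<n

      same-diamond : suc t / v ≡ t / v
      same-diamond = [1+t]/v≡t/v t [1+t]%v≢0

      s : ℕ
      s = t / v * v

      s%v≡0 : s % v ≡ 0
      s%v≡0 = m*n%n≡0 (t / v) v

      no-descent : Dec (t % v ≡ 0) → ¬ g (suc t) < g t
      no-descent (yes t%v≡0) = <-asym (least< t<n st<n (sym same-diamond) t%v≡0 [1+t]%v≢0)
      no-descent (no  t%v≢0) gst<gt = avoids132 s<t (n<1+n t) st<n (gs<gst , gst<gt)
        where
        s<t : s < t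
        s<t = ≤∧≢⇒< (m/n*n≤m t v) λ s≡t → t%v≢0 (subst (λ x → x % v ≡ 0) s≡t s%v≡0)

        gs<gst : g s < g (suc t)
        gs<gst = least< (<-trans s<t t<n) st<n
          (trans (m*n/n≡m (t / v) v) (sym same-diamond)) s%v≡0 [1+t]%v≢0

  module _ {n : ℕ} {cut : ℕ → Bool} (cuts-only-at-starts : ∀ {t} → t % v ≢ 0 → cut t ≡ false) where
    open SkewLayered n cut

    layered-IsDiamondLabelling : IsDiamondLabelling n layered
    layered-IsDiamondLabelling = record
      { least<    = λ {_} {q} _ q<n same p%v≡0 q%v≢0 → ascending q<n same
          (subst (_< q % v) (sym p%v≡0) (n≢0⇒n>0 q%v≢0))
      ; <greatest = λ {p} _ q<n same q%v≡w p%v≢w → ascending q<n same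
          (subst (p % v <_) (sym q%v≡w) (≤∧≢⇒< (≤-pred (m%n<n p v)) p%v≢w))
      }
      where
      ascending : ∀ {p q} → q < n → p / v ≡ q / v → p % v < q % v → layered p < layered q
      ascending q<n same %< = layered-<-within p<q
        (uncut⇒SameBlock (<⇒≤ p<q) q<n λ p<t t≤q → cuts-only-at-starts (%≢0-within same p<t t≤q))
        where p<q = /-%-<⇒< same %<

  -- Bit k of c says whether a new block starts with diamond k + 1.
  diamondCut : ∀ {e} → Vec Bool e → ℕ → Bool
  diamondCut c t = does (t % v ≟ 0) ∧ lookupOr false (false ∷ c) (t / v)

  diamondCut-only-at-starts : ∀ {e} (c : Vec Bool e) {t} → t % v ≢ 0 → diamondCut c t ≡ false
  diamondCut-only-at-starts c {t} t%v≢0 rewrite dec-false (t % v ≟ 0) t%v≢0 = refl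

  diamondCut-boundary : ∀ {e} (c : Vec Bool e) (k : Fin e) →
    diamondCut c (suc (toℕ k) * v) ≡ lookup c k
  diamondCut-boundary c k = trans
    (cong₂ (λ r b → does (r ≟ 0) ∧ lookupOr false (false ∷ c) b)
           (m*n%n≡0 (suc (toℕ k)) v) (m*n/n≡m (suc (toℕ k)) v))
    (lookupOr-toℕ false c k)

  module _ {n : ℕ} (π : Vec (Fin n) n) {g : ℕ → ℕ}
           (represents : ∀ i → toℕ (lookup π i) ≡ g (toℕ i)) where

    private
      <⇒< : ∀ {i j} → lookup π i Fin.< lookup π j → g (toℕ i) < g (toℕ j)
      <⇒< = subst₂ _<_ (represents _) (represents _)

      <⇐< : ∀ {i j} → g (toℕ i) < g (toℕ j) → lookup π i Fin.< lookup π j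
      <⇐< = subst₂ _<_ (sym (represents _)) (sym (represents _))

    InD⇒Av132∧213 : InD132-213 π v → Av132∧213 n g
    InD⇒Av132∧213 (is-perm , _ , avoids132 , avoids213) = record
      { injective = injective ; avoids132 = avoids132′ ; avoids213 = avoids213′ }
      where
      injective : ∀ {p q} → p < n → q < n → g p ≡ g q → p ≡ q
      injective p<n q<n gp≡gq with i , refl ← toFin p<n | j , refl ← toFin q<n =
        cong toℕ (is-perm i j (toℕ-injective
          (trans (represents i) (trans gp≡gq (sym (represents j))))))

      avoids132′ : ∀ {i j k} → i < j → j < k → k < n → ¬ (g i < g k × g k < g j)
      avoids132′ i<j j<k k<n (gi<gk , gk<gj)
        with i , refl ← toFin (<-trans i<j (<-trans j<k k<n))
           | j , refl ← toFin (<-trans j<k k<n) | k , refl ← toFin k<n =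
        avoids132 i j k i<j j<k (<⇐< gi<gk , <⇐< gk<gj)

      avoids213′ : ∀ {i j k} → i < j → j < k → k < n → ¬ (g j < g i × g i < g k)
      avoids213′ i<j j<k k<n (gj<gi , gi<gk)
        with i , refl ← toFin (<-trans i<j (<-trans j<k k<n))
           | j , refl ← toFin (<-trans j<k k<n) | k , refl ← toFin k<n =
        avoids213 i j k i<j j<k (<⇐< gj<gi , <⇐< gi<gk)

    InD⇒IsDiamondLabelling : InD132-213 π v → IsDiamondLabelling n g
    InD⇒IsDiamondLabelling (_ , diamond , _) = record { least< = least< ; <greatest = <greatest }
      where
      least< : ∀ {p q} → p < n → q < n → p / v ≡ q / v → p % v ≡ 0 → q % v ≢ 0 → g p < g q
      least< p<n q<n same p₀ q₀ with i , refl ← toFin p<n | j , refl ← toFin q<n =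
        <⇒< (proj₁ (diamond i j same) (p₀ , q₀))

      <greatest : ∀ {p q} → p < n → q < n → p / v ≡ q / v → q % v ≡ w → p % v ≢ w → g p < g q
      <greatest p<n q<n same q₀ p₀ with i , refl ← toFin p<n | j , refl ← toFin q<n =
        <⇒< (proj₂ (diamond i j same) (q₀ , p₀))

    Av132∧213∧IsDiamondLabelling⇒InD : Av132∧213 n g → IsDiamondLabelling n g → InD132-213 π v
    Av132∧213∧IsDiamondLabelling⇒InD G D =
        (λ i j eq → toℕ-injective (injective (toℕ<n i) (toℕ<n j)
                      (trans (sym (represents i)) (trans (cong toℕ eq) (represents j)))))
      , (λ i j same → (λ (i₀ , j₀) → <⇐< (least< (toℕ<n i) (toℕ<n j) same i₀ j₀))
                    , (λ (j₀ , i₀) → <⇐< (<greatest (toℕ<n i) (toℕ<n j) same j₀ i₀)))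
      , (λ i j k i<j j<k (πi<πk , πk<πj) → avoids132 i<j j<k (toℕ<n k) (<⇒< πi<πk , <⇒< πk<πj))
      , (λ i j k i<j j<k (πj<πi , πi<πk) → avoids213 i<j j<k (toℕ<n k) (<⇒< πj<πi , <⇒< πi<πk))
      where
      open Av132∧213 G
      open IsDiamondLabelling D

    represented-MapsInto : MapsInto n g
    represented-MapsInto p<n with i , refl ← toFin p<n =
      subst (_< n) (represents i) (toℕ<n (lookup π i))

    IsPerm⇒Onto : IsPerm π → Onto n g
    IsPerm⇒Onto is-perm x<n
      with i , πi≡x ← injective⇒surjective (lookup π) (is-perm _ _) (fromℕ< x<n) =
      toℕ i , toℕ<n i , trans (sym (represents i)) (trans (cong toℕ πi≡x) (toℕ-fromℕ< x<n))

-- Counting diamond labellings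

module Count (w e : ℕ) where
  open Diamonds w

  n : ℕ
  n = v * suc e

  boundary : Fin e → ℕ
  boundary k = w + toℕ k * v

  boundary<n : ∀ k → suc (boundary k) < n
  boundary<n k = subst (suc (boundary k) <_) (*-comm (suc e) v)
    (s≤s (+-monoʳ-< w (*-monoˡ-< v (toℕ<n k))))

  %≡0⇒boundary : ∀ {t} → suc t < n → suc t % v ≡ 0 → ∃ λ k → t ≡ boundary k
  %≡0⇒boundary {t} st<n [1+t]%v≡0 = diamond-boundary (suc t / v)
    (trans (m≡m%n+[m/n]*n (suc t) v) (cong (_+ suc t / v * v) [1+t]%v≡0))
    (m<n*o⇒m/o<n (subst (suc t <_) (*-comm v (suc e)) st<n))
    where
    diamond-boundary : ∀ b → suc t ≡ b * v → b < suc e → ∃ λ k → t ≡ boundary k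
    diamond-boundary (suc b) [1+t]≡[1+b]v (s≤s b<e) = fromℕ< b<e ,
      trans (suc-injective [1+t]≡[1+b]v) (cong (λ x → w + x * v) (sym (toℕ-fromℕ< b<e)))

  descentAt : Vec (Fin n) n → Fin e → Bool
  descentAt π k = does (valueAt π (suc (boundary k)) <? valueAt π (boundary k))

  descents : Vec (Fin n) n → Vec Bool e
  descents π = tabulate (descentAt π)

  module _ (c : Vec Bool e) where
    open SkewLayered n (diamondCut c)

    buildAt : Fin n → Fin n
    buildAt i = fromℕ< (layered<n (toℕ<n i))

    build : Vec (Fin n) n
    build = tabulate buildAt

    build-represents : ∀ i → toℕ (lookup build i) ≡ layered (toℕ i)
    build-represents i =
      trans (cong toℕ (lookup∘tabulate buildAt i)) (toℕ-fromℕ< (layered<n (toℕ<n i)))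

    build-valid : InD132-213 build v
    build-valid = Av132∧213∧IsDiamondLabelling⇒InD build build-represents
      layered-Av132∧213 (layered-IsDiamondLabelling λ {t} → diamondCut-only-at-starts c {t})

    valueAt-build : ∀ {p} → p < n → valueAt build p ≡ layered p
    valueAt-build p<n with i , refl ← toFin p<n =
      trans (sym (valueAt-represents build i)) (build-represents i)

    descents-build : descents build ≡ c
    descents-build = trans (tabulate-cong descentAt≡bit) (tabulate∘lookup c)
      where
      descentAt≡bit : ∀ k → descentAt build k ≡ lookup c k
      descentAt≡bit k = begin
        does (valueAt build (suc (boundary k)) <? valueAt build (boundary k))
          ≡⟨ cong₂ (λ x y → does (x <? y)) (valueAt-build (boundary<n k))
                                          (valueAt-build (<-trans (n<1+n _) (boundary<n k))) ⟩
        does (layered (suc (boundary k)) <? layered (boundary k))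
          ≡⟨ layered-descent≡cut (boundary<n k) ⟩
        diamondCut c (suc (toℕ k) * v)
          ≡⟨ diamondCut-boundary c k ⟩
        lookup c k ∎
        where open ≡-Reasoning

  module _ {π π′ : Vec (Fin n) n} (valid : InD132-213 π v) (valid′ : InD132-213 π′ v)
           (same-descents : descents π ≡ descents π′) where
    private
      g h : ℕ → ℕ
      g = valueAt π
      h = valueAt π′

      G : Av132∧213 n g
      G = InD⇒Av132∧213 π (valueAt-represents π) valid

      H : Av132∧213 n h
      H = InD⇒Av132∧213 π′ (valueAt-represents π′) valid′

      DG : IsDiamondLabelling n g
      DG = InD⇒IsDiamondLabelling π (valueAt-represents π) valid

      DH : IsDiamondLabelling n h
      DH = InD⇒IsDiamondLabelling π′ (valueAt-represents π′) valid′

    same-descentAt : ∀ k → descentAt π k ≡ descentAt π′ k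
    same-descentAt k = trans (sym (lookup∘tabulate (descentAt π) k))
      (trans (cong (λ bits → lookup bits k) same-descents) (lookup∘tabulate (descentAt π′) k))

    same-ascents : SameAscents n g h
    same-ascents {t} st<n with suc t % v ≟ 0
    ... | no [1+t]%v≢0 = mk⇔ (λ _ → ascent-within-diamond H DH st<n [1+t]%v≢0)
                             (λ _ → ascent-within-diamond G DG st<n [1+t]%v≢0)
    ... | yes [1+t]%v≡0 with k , refl ← %≡0⇒boundary st<n [1+t]%v≡0 =
      mk⇔ (descent-agreement⇒ascent {g = g} H st<n (same-descentAt k))
          (descent-agreement⇒ascent {g = h} G st<n (sym (same-descentAt k)))

    same-values : ∀ {p} → p < n → g p ≡ h p
    same-values = same-order⇒≡
      (represented-MapsInto π (valueAt-represents π))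
      (represented-MapsInto π′ (valueAt-represents π′))
      (IsPerm⇒Onto π (valueAt-represents π) (proj₁ valid))
      (IsPerm⇒Onto π′ (valueAt-represents π′) (proj₁ valid′))
      (same-ascents⇒same-order G H same-ascents)
      (same-ascents⇒same-order H G λ st<n → ⇔-sym (same-ascents st<n))

    descents-injective : π ≡ π′
    descents-injective = begin
      π                    ≡⟨ tabulate∘lookup π ⟨
      tabulate (lookup π)  ≡⟨ tabulate-cong same-lookup ⟩
      tabulate (lookup π′) ≡⟨ tabulate∘lookup π′ ⟩
      π′                   ∎
      where
      open ≡-Reasoning
      same-lookup : ∀ i → lookup π i ≡ lookup π′ i
      same-lookup i = toℕ-injective (trans (valueAt-represents π i)
        (trans (same-values (toℕ<n i)) (sym (valueAt-represents π′ i))))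

  valid? : (π : Vec (Fin n) n) → Dec (InD132-213 π v)
  valid? π = inD? π v

  validWords : List (Vec (Fin n) n)
  validWords = filter valid? (allVecs (allFin n) n)

  bools : List Bool
  bools = true ∷ false ∷ []

  length-validWords≤ : length validWords ≤ length (allVecs bools e)
  length-validWords≤ = length-≤-of-injective descents
    (filter⁺ valid? (allVecs-unique (allFin n) (allFin⁺ n) n))
    (λ {π} _ → ∈-allVecs bools every-bool (descents π))
    (λ π∈ π′∈ → descents-injective (valid-of π∈) (valid-of π′∈))
    where
    every-bool : ∀ b → b ∈ bools
    every-bool true  = here refl
    every-bool false = there (here refl)

    valid-of : ∀ {π} → π ∈ validWords → InD132-213 π v
    valid-of π∈ = proj₂ (∈-filter⁻ valid? {xs = allVecs (allFin n) n} π∈)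

  ≤length-validWords : length (allVecs bools e) ≤ length validWords
  ≤length-validWords = length-≤-of-injective build
    (allVecs-unique bools (((λ ()) ∷ []) ∷ [] ∷ []) e)
    (λ {c} _ → ∈-filter⁺ valid? (∈-allVecs (allFin n) ∈-allFin (build c)) (build-valid c))
    (λ {c} {c′} _ _ same → begin
      c                  ≡⟨ descents-build c ⟨
      descents (build c)  ≡⟨ cong descents same ⟩
      descents (build c′) ≡⟨ descents-build c′ ⟩
      c′                 ∎)
    where open ≡-Reasoning

corollary3p3 : (v d : ℕ) → 4 ≤ v → 1 ≤ d → countD132-213 v d ≡ 2 ^ (d ∸ 1)
corollary3p3 (suc w) (suc e) _ _ = begin
  length validWords        ≡⟨ ≤-antisym length-validWords≤ ≤length-validWords ⟩
  length (allVecs bools e) ≡⟨ length-allVecs bools e ⟩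
  2 ^ e                    ∎
  where
  open Count w e
  open ≡-Reasoning
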